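{- Let $m$ be a natural number. Then $\omega\to(\widetilde{\mathcal{ED}}_m^+)^2_{m+1}$ but $\omega\not\to(\widetilde{\mathcal{ED}}_m^+)^2_{m+2}$.
   Context: Fix a family $\{A_s\subseteq\omega: s\in\omega^{<\omega}\}$ such that $A_\emptyset=\omega$, every $A_s$ is infinite, $\{A_{s^\frown n}:n\in\omega\}$ is a partition of $A_s$, and for distinct $n,m\in\omega$ there exist $s\neq t$ in $\omega^{<\omega}$ with $n\in A_s$, $m\in A_t$. Let $\mathcal{B}=\{A\subseteq\omega: \exists s\in\omega^{<\omega}\,(A\subseteq A_s\wedge\forall n\in\omega\ |A\cap A_{s^\frown n}|=1)\}$ and $\mathcal{A}_m=\{A_s: |s|=m+1\}$. $\widetilde{\mathcal{ED}}_m$ is the ideal on $\omega$ generated by $\mathcal{A}_m\cup\mathcal{B}$ (and the finite sets). For an ideal $\mathcal{I}$, $\mathcal{I}^+$ is the family of subsets of $\omega$ not in $\mathcal{I}$, and $\omega\to(\mathcal{I}^+)^2_k$ means: for every $c:[\omega]^2\to k$ there is $A\in\mathcal{I}^+$ with $|c[[A]^2]|=1$. -}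

module Defs where

open import Level using (0ℓ)
open import Data.Nat using (ℕ; suc; _<_; _≤_)
open import Data.Fin using (Fin)
open import Data.List using (List; []; _∷_; _++_; [_]; length)
open import Data.List.Relation.Unary.All using (All)
open import Data.List.Relation.Unary.Any using (Any)
open import Data.Product using (Σ; ∃; _×_; _,_)
open import Data.Sum using (_⊎_)
open import Relation.Unary using (Pred; _⊆_)
open import Relation.Binary.PropositionalEquality using (_≡_; _≢_)
open import Relation.Nullary using (¬_)

Subset : Set₁
Subset = Pred ℕ 0ℓ

_⌢_ : List ℕ → ℕ → List ℕ
s ⌢ n = s ++ [ n ]

Infinite : Subset → Set
Infinite X = ∀ N → ∃ λ n → N ≤ n × X n

record TreeFamily (A : List ℕ → Subset) : Set where
  field
    root      : ∀ n → A [] n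
    infinite  : ∀ s → Infinite (A s)
    sub       : ∀ s n → A (s ⌢ n) ⊆ A s
    cover     : ∀ s x → A s x → ∃ λ n → A (s ⌢ n) x
    disjoint  : ∀ s n n′ x → A (s ⌢ n) x → A (s ⌢ n′) x → n ≡ n′
    separated : ∀ n m → n ≢ m →
                Σ (List ℕ) λ s → Σ (List ℕ) λ t →
                  length s ≡ length t × s ≢ t × A s n × A t m

ExactlyOne : Subset → Subset → Set
ExactlyOne Y Z = ∃ λ x → (Y x × Z x) × (∀ y → Y y → Z y → y ≡ x)

InB : (List ℕ → Subset) → Subset → Set
InB A Y = ∃ λ s → (Y ⊆ A s) × (∀ n → ExactlyOne Y (A (s ⌢ n)))

-- Y ⊆ some member of 𝓐_m, or Y ∈ 𝓑 (subsets suffice: the ideal is downward closed)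
Generator : ℕ → (List ℕ → Subset) → Subset → Set
Generator m A Y = (Σ (List ℕ) λ s → length s ≡ suc m × Y ⊆ A s) ⊎ InB A Y

InED : ℕ → (List ℕ → Subset) → Subset → Set₁
InED m A X = Σ ℕ λ N → Σ (List Subset) λ Gs →
  All (Generator m A) Gs × (∀ x → X x → x < N ⊎ Any (λ G → G x) Gs)

-- ω → (𝓘⁺)²_k : colourings of [ω]² as c x y for x < y.
Arrow : (Subset → Set₁) → ℕ → Set₁
Arrow I k = (c : ℕ → ℕ → Fin k) →
  Σ Subset λ X → ¬ I X × ∃ λ (i : Fin k) →
    ∀ x y → X x → X y → x < y → c x y ≡ i

module Submission where

-- Negative part: colour a pair by the level, capped at m + 1, at which the tree separates its
-- two points. A homogeneous set of colour v ≤ m lies in one node of level v and meets each of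
-- its children at most once, so it extends to a selector in 𝓑; a homogeneous set of colour
-- m + 1 lies in a single node of level m + 1. Either way it belongs to the ideal.
--
-- Positive part: a list of length m + 2 codes a point of the node addressed by its first
-- m + 1 entries. For each τ ≤ m + 1, a pair of codes agreeing on their first τ entries, the
-- remaining entries of the second lying above those of the first, is itself coded by one
-- increasing list, and Ramsey's theorem yields an infinite set on which the colour of such
-- pairs depends on τ alone; by pigeonhole two values τ₁ < τ₂ share a colour. Row r consists
-- of r + 1 codes sharing their first τ₂ entries, and a later row shares only the first τ₁
-- entries with an earlier one, so all row points together form a homogeneous set. Since the
-- entry of row r at position τ₁ grows with r, a fixed node of level > τ₁ eventually misses
-- the rows, while a selector at a node of level ≤ τ₁ meets each row at most once; hence
-- finitely many generators cannot cover a long enough row.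

open import Defs
open import Level using (0ℓ; Lift; lift; lower)
open import Function using (_∘_; id)
open import Data.Empty using (⊥-elim)
open import Data.Nat using (ℕ; zero; suc; _+_; _*_; _∸_; _≤_; _<_; _≟_; _<?_; _⊓_; _⊔_; z≤n; s≤s; z<s)
open import Data.Nat.Properties
open import Data.Nat.ListAction using (sum)
open import Data.Nat.ListAction.Properties using (sum-++)
open import Data.Fin using (Fin; zero; suc; toℕ)
open import Data.Fin.Properties using (toℕ<n; pigeonhole)
open import Data.List using (List; []; _∷_; _++_; [_]; length; map; take; drop; applyUpTo; lookup; initLast; _∷ʳ′_)
open import Data.List.Properties
  using ( length-++; length-map; length-take; length-drop; length-applyUpTo; take-map; drop-map; map-++
        ; ++-assoc; ++-identityʳ; take++drop≡id; take-all; take-take; map-injective; ++-cancelˡ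
        ; ∷-injectiveˡ; ∷ʳ-injectiveʳ)
open import Data.List.Relation.Unary.All as All using (All; []; _∷_)
import Data.List.Relation.Unary.All.Properties as All
open import Data.List.Relation.Unary.Any using (Any; here; there; index)
open import Data.List.Relation.Unary.Any.Properties using (lookup-index)
open import Data.List.Relation.Unary.AllPairs as AllPairs using (AllPairs; []; _∷_)
import Data.List.Relation.Unary.AllPairs.Properties as AllPairs
open import Data.List.Membership.Propositional using (_∈_)
open import Data.List.Membership.Propositional.Properties using (∈-lookup; ∈-map⁺; ∈-++⁺ʳ)
open import Data.Product using (Σ; ∃; ∃₂; _×_; _,_; proj₁; proj₂)
open import Data.Sum using (_⊎_; inj₁; inj₂)
open import Relation.Nullary using (¬_; Dec; yes; no)
open import Relation.Nullary.Decidable using (map′)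
open import Relation.Unary using (U; _⊆_; _∩_; _∪_)
open import Data.Unit using (tt)
open import Relation.Binary.PropositionalEquality
  using (_≡_; _≢_; refl; sym; trans; cong; cong₂; subst; subst₂; module ≡-Reasoning)
open import Relation.Binary.Definitions using (tri<; tri≈; tri>)
open import Axiom.ExcludedMiddle using (ExcludedMiddle)

StrictlyIncreasing : (ℕ → ℕ) → Set
StrictlyIncreasing f = ∀ n → f n < f (suc n)

module _ {f : ℕ → ℕ} (f↑ : StrictlyIncreasing f) where

  strictlyIncreasing⇒mono-< : ∀ {m n} → m < n → f m < f n
  strictlyIncreasing⇒mono-< {m} (s≤s m≤n) with m≤n⇒∃[o]m+o≡n m≤n
  ... | o , refl = go o
    where
    go : ∀ o → f m < f (suc (m + o))
    go zero rewrite +-identityʳ m = f↑ m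
    go (suc o) rewrite +-suc m o = <-trans (go o) (f↑ (suc (m + o)))

  strictlyIncreasing⇒mono-≤ : ∀ {m n} → m ≤ n → f m ≤ f n
  strictlyIncreasing⇒mono-≤ m≤n with m≤n⇒m<n∨m≡n m≤n
  ... | inj₁ m<n  = <⇒≤ (strictlyIncreasing⇒mono-< m<n)
  ... | inj₂ refl = ≤-refl

  strictlyIncreasing⇒cancel-< : ∀ {m n} → f m < f n → m < n
  strictlyIncreasing⇒cancel-< fm<fn = ≰⇒> λ n≤m → <⇒≱ fm<fn (strictlyIncreasing⇒mono-≤ n≤m)

  strictlyIncreasing⇒injective : ∀ {m n} → f m ≡ f n → m ≡ n
  strictlyIncreasing⇒injective {m} {n} fm≡fn with <-cmp m n
  ... | tri< m<n _ _ = ⊥-elim (<-irrefl fm≡fn (strictlyIncreasing⇒mono-< m<n))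
  ... | tri≈ _ m≡n _ = m≡n
  ... | tri> _ _ n<m = ⊥-elim (<-irrefl (sym fm≡fn) (strictlyIncreasing⇒mono-< n<m))

  strictlyIncreasing⇒inflationary : ∀ n → n ≤ f n
  strictlyIncreasing⇒inflationary zero    = z≤n
  strictlyIncreasing⇒inflationary (suc n) = <-≤-trans (s≤s (strictlyIncreasing⇒inflationary n)) (f↑ n)

module _ {X : Subset} (X-inf : Infinite X) where

  enumerate : ℕ → ℕ
  enumerate zero    = proj₁ (X-inf 0)
  enumerate (suc n) = proj₁ (X-inf (suc (enumerate n)))

  enumerate-∈ : ∀ n → X (enumerate n)
  enumerate-∈ zero    = proj₂ (proj₂ (X-inf 0))
  enumerate-∈ (suc n) = proj₂ (proj₂ (X-inf (suc (enumerate n))))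

  enumerate-↑ : StrictlyIncreasing enumerate
  enumerate-↑ n = proj₁ (proj₂ (X-inf (suc (enumerate n))))

Increasing : List ℕ → Set
Increasing = AllPairs _<_

map-increasing : ∀ {f w} → StrictlyIncreasing f → Increasing w → Increasing (map f w)
map-increasing f↑ w↑ = AllPairs.map⁺ (AllPairs.map (strictlyIncreasing⇒mono-< f↑) w↑)

interval : ℕ → ℕ → List ℕ
interval a n = applyUpTo (_+ a) n

IncreasingFrom : ℕ → List ℕ → Set
IncreasingFrom a ys = Increasing ys × All (a ≤_) ys

interval-++ : ∀ {a n b ys} → a + n ≤ b → IncreasingFrom b ys → IncreasingFrom a (interval a n ++ ys)
interval-++ {a} {n} a+n≤b (ys↑ , ys≥) =
  AllPairs.++⁺ (AllPairs.applyUpTo⁺₁ (_+ a) n (λ k<l _ → +-monoˡ-< a k<l)) ys↑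
    (All.applyUpTo⁺₁ (_+ a) n (λ {k} k<n → All.map (<-≤-trans (below k<n)) ys≥))
  , All.++⁺ (All.applyUpTo⁺₂ (_+ a) n (λ k → m≤n+m a k)) (All.map (≤-trans (≤-trans (m≤m+n a n) a+n≤b)) ys≥)
  where
  below : ∀ {k} → k < n → k + a < _
  below {k} k<n = <-≤-trans (subst (k + a <_) (+-comm n a) (+-monoˡ-< a k<n)) a+n≤b

interval-increasingFrom : ∀ a n → IncreasingFrom a (interval a n)
interval-increasingFrom a n =
  subst (IncreasingFrom a) (++-identityʳ (interval a n)) (interval-++ {b = a + n} ≤-refl ([] , []))

module _ {a} {X : Set a} where

  take-++ : ∀ {n} (xs : List X) {ys} → n ≤ length xs → take n (xs ++ ys) ≡ take n xs
  take-++ {zero}  xs       _         = refl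
  take-++ {suc n} (x ∷ xs) (s≤s n≤) = cong (x ∷_) (take-++ xs n≤)

  take-length-++ : ∀ {n} (xs : List X) {ys} → length xs ≡ n → take n (xs ++ ys) ≡ xs
  take-length-++ []       refl = refl
  take-length-++ (x ∷ xs) refl = cong (x ∷_) (take-length-++ xs refl)

  drop-length-++ : ∀ {n} (xs : List X) {ys} → length xs ≡ n → drop n (xs ++ ys) ≡ ys
  drop-length-++ []       refl = refl
  drop-length-++ (x ∷ xs) refl = drop-length-++ xs refl

  ∈-take-++ : ∀ {n y} (xs : List X) {ys} → length xs < n → y ∈ take n (xs ++ y ∷ ys)
  ∈-take-++ {suc n} []       _          = here refl
  ∈-take-++ {suc n} (x ∷ xs) (s≤s xs<n) = there (∈-take-++ xs xs<n)

  ∈-take : ∀ {n x} {xs : List X} → x ∈ take n xs → x ∈ xs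
  ∈-take {suc n} {xs = _ ∷ _} (here x≡)  = here x≡
  ∈-take {suc n} {xs = _ ∷ _} (there x∈) = there (∈-take x∈)

∈⇒≤sum : ∀ {x xs} → x ∈ xs → x ≤ sum xs
∈⇒≤sum {xs = y ∷ ys} (here refl) = m≤m+n y (sum ys)
∈⇒≤sum {xs = y ∷ ys} (there x∈)  = ≤-trans (∈⇒≤sum x∈) (m≤n+m (sum ys) y)

length≡1⇒≡[sum] : ∀ {xs} → length xs ≡ 1 → xs ≡ [ sum xs ]
length≡1⇒≡[sum] {x ∷ []} refl = cong [_] (sym (+-identityʳ x))

-- Ramsey's theorem

Homogeneous : ∀ {r} → (List ℕ → Fin r) → ℕ → Subset → Fin r → Set
Homogeneous col k H e = ∀ w → length w ≡ k → Increasing w → All H w → col w ≡ e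

homogeneous-⊆ : ∀ {r} {col : List ℕ → Fin r} {k H H′ e} → H′ ⊆ H →
                Homogeneous col k H e → Homogeneous col k H′ e
homogeneous-⊆ H′⊆H hom w |w| w↑ w∈ = hom w |w| w↑ (All.map H′⊆H w∈)

record InfiniteSubset (H : Subset) (P : Subset → Set) : Set₁ where
  field
    carrier          : Subset
    carrier⊆H        : carrier ⊆ H
    carrier-infinite : Infinite carrier
    property         : P carrier

HomogeneousSubset : ∀ {r} → (List ℕ → Fin r) → ℕ → Subset → Set₁
HomogeneousSubset col k H = InfiniteSubset H (λ H′ → ∃ (Homogeneous col k H′))

module Classical (lem : ExcludedMiddle (Level.suc 0ℓ)) where

  decide : (P : Set) → Dec P
  decide P = map′ lower lift (lem {Lift _ P})

  double-negation : {P : Set} → ¬ ¬ P → P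
  double-negation {P} ¬¬p with decide P
  ... | yes p = p
  ... | no ¬p = ⊥-elim (¬¬p ¬p)

  infinite-∪ : ∀ {P Q : Subset} → Infinite (P ∪ Q) → Infinite P ⊎ Infinite Q
  infinite-∪ {P} {Q} P∪Q-inf with decide (Infinite P)
  ... | yes P-inf = inj₁ P-inf
  ... | no ¬P-inf = inj₂ Q-inf
    where
    eventually-¬P : ∃ λ b → ∀ n → b ≤ n → ¬ P n
    eventually-¬P = double-negation λ ¬ev → ¬P-inf λ N →
      double-negation λ ¬P≥N → ¬ev (N , λ n N≤n Pn → ¬P≥N (n , N≤n , Pn))
    Q-inf : Infinite Q
    Q-inf N with eventually-¬P | P∪Q-inf (N ⊔ proj₁ eventually-¬P)
    ... | b , ¬P | n , N⊔b≤n , inj₁ Pn = ⊥-elim (¬P n (≤-trans (m≤n⊔m N b) N⊔b≤n) Pn)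
    ... | b , _  | n , N⊔b≤n , inj₂ Qn = n , ≤-trans (m≤m⊔n N b) N⊔b≤n , Qn

  infinite-pigeonhole : ∀ {r} (P : Fin r → Subset) → Infinite (λ n → ∃ λ e → P e n) → ∃ λ e → Infinite (P e)
  infinite-pigeonhole {zero} P inf with inf 0
  ... | _ , _ , () , _
  infinite-pigeonhole {suc r} P inf with infinite-∪ {P zero} {λ n → ∃ λ e → P (suc e) n} (split ∘ inf)
    where
    split : ∀ {N} → (∃ λ n → N ≤ n × ∃ λ e → P e n) →
            ∃ λ n → N ≤ n × (P zero n ⊎ ∃ λ e → P (suc e) n)
    split (n , N≤n , zero  , p) = n , N≤n , inj₁ p
    split (n , N≤n , suc e , p) = n , N≤n , inj₂ (e , p)
  ... | inj₁ P₀-inf = zero , P₀-inf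
  ... | inj₂ P₊-inf = let (e , Pₑ-inf) = infinite-pigeonhole (P ∘ suc) P₊-inf in suc e , Pₑ-inf

module Ramsey (lem : ExcludedMiddle (Level.suc 0ℓ)) where
  open Classical lem
  open InfiniteSubset

  module RamseyStep {k r} (ramsey-k : ∀ (col : List ℕ → Fin (suc r)) {H} → Infinite H → HomogeneousSubset col k H)
                    (col : List ℕ → Fin (suc r)) {H : Subset} (H-inf : Infinite H) where

    Stage : Set₁
    Stage = Σ Subset Infinite

    pivot : Stage → ℕ
    pivot (_ , S-inf) = proj₁ (S-inf 0)

    beyond-pivot : (σ : Stage) → Infinite (proj₁ σ ∩ (pivot σ <_))
    beyond-pivot σ@(_ , S-inf) N with S-inf (N ⊔ suc (pivot σ))
    ... | n , ≤n , Sn = n , ≤-trans (m≤m⊔n N _) ≤n , Sn , ≤-trans (m≤n⊔m N _) ≤n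

    refine : (σ : Stage) → HomogeneousSubset (λ w → col (pivot σ ∷ w)) k (proj₁ σ ∩ (pivot σ <_))
    refine σ = ramsey-k (λ w → col (pivot σ ∷ w)) (beyond-pivot σ)

    stage : ℕ → Stage
    stage zero    = H , H-inf
    stage (suc n) = carrier (refine (stage n)) , carrier-infinite (refine (stage n))

    S : ℕ → Subset
    S n = proj₁ (stage n)

    a : ℕ → ℕ
    a n = pivot (stage n)

    colour : ℕ → Fin (suc r)
    colour n = proj₁ (property (refine (stage n)))

    a-∈ : ∀ n → S n (a n)
    a-∈ n = proj₂ (proj₂ (proj₂ (stage n) 0))

    S-antitone : ∀ {n} n′ → n ≤ n′ → S n′ ⊆ S n
    S-antitone zero z≤n = id
    S-antitone (suc n′) n≤ with m≤n⇒m<n∨m≡n n≤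
    ... | inj₂ refl       = id
    ... | inj₁ (s≤s n≤n′) = S-antitone n′ n≤n′ ∘ proj₁ ∘ carrier⊆H (refine (stage n′))

    a-↑ : StrictlyIncreasing a
    a-↑ n = proj₂ (carrier⊆H (refine (stage n)) (a-∈ (suc n)))

    popular : ∃ λ e → Infinite (λ n → colour n ≡ e)
    popular = infinite-pigeonhole (λ e n → colour n ≡ e) λ N → N , ≤-refl , _ , refl

    e : Fin (suc r)
    e = proj₁ popular

    Pivots : Subset
    Pivots x = ∃ λ n → colour n ≡ e × a n ≡ x

    Pivots⊆H : Pivots ⊆ H
    Pivots⊆H (n , _ , refl) = S-antitone n z≤n (a-∈ n)

    Pivots-inf : Infinite Pivots
    Pivots-inf N with proj₂ popular N
    ... | n , N≤n , cₙ≡e = a n , ≤-trans N≤n (strictlyIncreasing⇒inflationary a-↑ n) , n , cₙ≡e , refl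

    later-∈ : ∀ {n x} → a n < x → Pivots x → S (suc n) x
    later-∈ {n} aₙ<x (n′ , _ , refl) = S-antitone {suc n} n′ (strictlyIncreasing⇒cancel-< a-↑ aₙ<x) (a-∈ n′)

    Pivots-hom : Homogeneous col (suc k) Pivots e
    Pivots-hom (_ ∷ w) |w| (x<w ∷ w↑) ((n , cₙ≡e , refl) ∷ w∈) =
      trans (proj₂ (property (refine (stage n))) w (suc-injective |w|) w↑ w⊆Sₙ₊₁) cₙ≡e
      where
      w⊆Sₙ₊₁ : All (S (suc n)) w
      w⊆Sₙ₊₁ = All.zipWith (λ (x<y , y∈) → later-∈ {n} x<y y∈) (x<w , w∈)

    result : HomogeneousSubset col (suc k) H
    result = record
      { carrier = Pivots ; carrier⊆H = Pivots⊆H ; carrier-infinite = Pivots-inf ; property = e , Pivots-hom }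

  ramsey : ∀ k {r} (col : List ℕ → Fin (suc r)) {H} → Infinite H → HomogeneousSubset col k H
  ramsey zero    col {H} H-inf = record
    { carrier = H ; carrier⊆H = id ; carrier-infinite = H-inf ; property = col [] , λ { [] refl _ _ → refl } }
  ramsey (suc k) col     H-inf = RamseyStep.result (ramsey k) col H-inf

  ramsey-family : ∀ {n r} (cols : Fin n → List ℕ → Fin (suc r)) (arity : Fin n → ℕ) {H} → Infinite H →
                  InfiniteSubset H (λ H′ → ∀ τ → ∃ (Homogeneous (cols τ) (arity τ) H′))
  ramsey-family {zero} cols arity H-inf = record
    { carrier = _ ; carrier⊆H = id ; carrier-infinite = H-inf ; property = λ () }
  ramsey-family {suc n} cols arity {H} H-inf = record
    { carrier = carrier rest ; carrier⊆H = carrier⊆H first ∘ carrier⊆H rest ; carrier-infinite = carrier-infinite rest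
    ; property = λ { zero    → let (e , hom) = property first in e , homogeneous-⊆ (carrier⊆H rest) hom
                   ; (suc τ) → property rest τ } }
    where
    first : HomogeneousSubset (cols zero) (arity zero) H
    first = ramsey (arity zero) (cols zero) H-inf

    rest : InfiniteSubset (carrier first) (λ H′ → ∀ τ → ∃ (Homogeneous (cols (suc τ)) (arity (suc τ)) H′))
    rest = ramsey-family (cols ∘ suc) (arity ∘ suc) (carrier-infinite first)

-- Addresses in the tree

length-⌢ : ∀ t n → length (t ⌢ n) ≡ suc (length t)
length-⌢ t n = trans (length-++ t) (+-comm (length t) 1)

module Addresses {A : List ℕ → Subset} (TF : TreeFamily A) where
  open TreeFamily TF

  located : (x L : ℕ) → ∃ λ u → A u x
  located x zero    = [] , root x
  located x (suc L) = proj₁ (located x L) ⌢ proj₁ next , proj₂ next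
    where next = cover (proj₁ (located x L)) x (proj₂ (located x L))

  address : ℕ → ℕ → List ℕ
  address x L = proj₁ (located x L)

  branch : ℕ → ℕ → ℕ
  branch x L = proj₁ (cover (address x L) x (proj₂ (located x L)))

  ∈-address : ∀ x L → A (address x L) x
  ∈-address x L = proj₂ (located x L)

  length-address : ∀ x L → length (address x L) ≡ L
  length-address x zero    = refl
  length-address x (suc L) = trans (length-⌢ (address x L) (branch x L)) (cong suc (length-address x L))

  address-unique : ∀ {x} L u → length u ≡ L → A u x → u ≡ address x L
  address-unique L u |u| x∈u with initLast u
  address-unique zero    _ _   _   | [] = refl
  address-unique (suc L) _ ()  _   | []
  address-unique zero    _ |u| _   | t ∷ʳ′ n = ⊥-elim (1+n≢0 (trans (sym (length-⌢ t n)) |u|))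
  address-unique {x} (suc L) _ |u| x∈u | t ∷ʳ′ n
    with refl ← address-unique L t (suc-injective (trans (sym (length-⌢ t n)) |u|)) (sub t n x∈u)
    = cong (address x L ⌢_) (disjoint (address x L) n (branch x L) x x∈u (∈-address x (suc L)))

  branch-unique : ∀ {x L t n} → length t ≡ L → A (t ⌢ n) x → branch x L ≡ n
  branch-unique {x} {L} {t} {n} |t| x∈tn =
    sym (∷ʳ-injectiveʳ t (address x L) (address-unique (suc L) (t ⌢ n) (trans (length-⌢ t n) (cong suc |t|)) x∈tn))

  address-take : ∀ {x L} L′ → L ≤ L′ → take L (address x L′) ≡ address x L
  address-take {x} {L} L′ L≤L′ with m≤n⇒m<n∨m≡n L≤L′
  ... | inj₂ refl = take-all L (address x L) (≤-reflexive (length-address x L))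
  address-take {x} {L} (suc L′) _ | inj₁ (s≤s L≤L′) =
    trans (take-++ (address x L′) (≤-trans L≤L′ (≤-reflexive (sym (length-address x L′)))))
          (address-take L′ L≤L′)

  address-cong : ∀ {x y} L → (∀ {l} → l < L → branch x l ≡ branch y l) → address x L ≡ address y L
  address-cong zero    _     = refl
  address-cong (suc L) agree = cong₂ _⌢_ (address-cong L (agree ∘ m<n⇒m<1+n)) (agree ≤-refl)

-- The split-level colouring

agreement : (k : ℕ) → (ℕ → ℕ) → (ℕ → ℕ) → Fin (suc k)
agreement zero    f g = zero
agreement (suc k) f g with f 0 ≟ g 0
... | yes _ = suc (agreement k (f ∘ suc) (g ∘ suc))
... | no  _ = zero

agreement-agree : ∀ k f g {l} → l < toℕ (agreement k f g) → f l ≡ g l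
agreement-agree (suc k) f g {l} l< with f 0 ≟ g 0 | l | l<
... | yes f₀≡g₀ | zero  | _        = f₀≡g₀
... | yes _     | suc l | s≤s l<′  = agreement-agree k (f ∘ suc) (g ∘ suc) l<′

agreement-disagree : ∀ k f g → toℕ (agreement k f g) < k →
                     f (toℕ (agreement k f g)) ≢ g (toℕ (agreement k f g))
agreement-disagree (suc k) f g a<k with f 0 ≟ g 0
... | yes _     = agreement-disagree k (f ∘ suc) (g ∘ suc) (≤-pred a<k)
... | no f₀≢g₀ = f₀≢g₀

covered-by-generator : ∀ {m A G X} → Generator m A G → X ⊆ G → InED m A X
covered-by-generator {G = G} g X⊆G = 0 , G ∷ [] , g ∷ [] , λ _ Xx → inj₂ (here (X⊆G Xx))

module SplitLevelColouring (lem : ExcludedMiddle (Level.suc 0ℓ)) {A : List ℕ → Subset} (TF : TreeFamily A)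
                           (m : ℕ) where
  open TreeFamily TF
  open Addresses TF
  open Classical lem

  extend-to-selector : ∀ {X t} → X ⊆ A t →
    (∀ n {x y} → X x → X y → A (t ⌢ n) x → A (t ⌢ n) y → x ≡ y) → ∃ λ Y → X ⊆ Y × InB A Y
  extend-to-selector {X} {t} X⊆At X-thin = Y , inj₁ , t , Y⊆At , exactlyOne
    where
    Empty : ℕ → Set
    Empty n = ¬ (∃ λ z → X z × A (t ⌢ n) z)

    some : ℕ → ℕ
    some n = proj₁ (infinite (t ⌢ n) 0)

    some-∈ : ∀ n → A (t ⌢ n) (some n)
    some-∈ n = proj₂ (proj₂ (infinite (t ⌢ n) 0))

    Y : Subset
    Y x = X x ⊎ ∃ λ n → Empty n × some n ≡ x

    Y⊆At : Y ⊆ A t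
    Y⊆At (inj₁ Xx)             = X⊆At Xx
    Y⊆At (inj₂ (n , _ , refl)) = sub t n (some-∈ n)

    filler-unique : ∀ {n y} → Empty n → Y y → A (t ⌢ n) y → y ≡ some n
    filler-unique empty (inj₁ Xy)              y∈ = ⊥-elim (empty (_ , Xy , y∈))
    filler-unique {n} _ (inj₂ (n′ , _ , refl)) y∈
      with refl ← disjoint t n′ n (some n′) (some-∈ n′) y∈ = refl

    exactlyOne : ∀ n → ExactlyOne Y (A (t ⌢ n))
    exactlyOne n with decide (∃ λ z → X z × A (t ⌢ n) z)
    ... | no empty = some n , (inj₂ (n , empty , refl) , some-∈ n) , λ _ → filler-unique empty
    ... | yes (z , Xz , z∈) = z , (inj₁ Xz , z∈) , unique
      where
      unique : ∀ y → Y y → A (t ⌢ n) y → y ≡ z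
      unique y (inj₁ Xy) y∈ = X-thin n Xy Xz y∈ z∈
      unique y (inj₂ (n′ , empty , refl)) y∈
        with refl ← disjoint t n′ n (some n′) (some-∈ n′) y∈ = ⊥-elim (empty (z , Xz , z∈))

  splitColour : ℕ → ℕ → Fin (suc (suc m))
  splitColour x y = agreement (suc m) (branch x) (branch y)

  module _ {X : Subset} {e : Fin (suc (suc m))}
           (X-hom : ∀ x y → X x → X y → x < y → splitColour x y ≡ e) where

    v : ℕ
    v = toℕ e

    ordered-shared-address : ∀ {x y} → X x → X y → x < y → address x v ≡ address y v
    ordered-shared-address {x} {y} Xx Xy x<y = address-cong v λ {l} l<v →
      agreement-agree (suc m) (branch x) (branch y) (subst (λ c → l < toℕ c) (sym (X-hom x y Xx Xy x<y)) l<v)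

    ordered-distinct-branches : ∀ {x y} → X x → X y → x < y → v < suc m → branch x v ≢ branch y v
    ordered-distinct-branches {x} {y} Xx Xy x<y v<
      rewrite sym (X-hom x y Xx Xy x<y) = agreement-disagree (suc m) (branch x) (branch y) v<

    shared-address : ∀ {x y} → X x → X y → address x v ≡ address y v
    shared-address {x} {y} Xx Xy with <-cmp x y
    ... | tri< x<y _ _ = ordered-shared-address Xx Xy x<y
    ... | tri≈ _ refl _ = refl
    ... | tri> _ _ y<x = sym (ordered-shared-address Xy Xx y<x)

    same-branch⇒≡ : ∀ {x y} → X x → X y → v < suc m → branch x v ≡ branch y v → x ≡ y
    same-branch⇒≡ {x} {y} Xx Xy v< same with <-cmp x y
    ... | tri< x<y _ _ = ⊥-elim (ordered-distinct-branches Xx Xy x<y v< same)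
    ... | tri≈ _ x≡y _ = x≡y
    ... | tri> _ _ y<x = ⊥-elim (ordered-distinct-branches Xy Xx y<x v< (sym same))

    homogeneous-InED : InED m A X
    homogeneous-InED with decide (∃ X)
    ... | no X-empty = 0 , [] , [] , λ x Xx → ⊥-elim (X-empty (x , Xx))
    ... | yes (x₀ , Xx₀) = covered (v <? suc m)
      where
      t : List ℕ
      t = address x₀ v

      |t| : length t ≡ v
      |t| = length-address x₀ v

      X⊆At : X ⊆ A t
      X⊆At {x} Xx = subst (λ u → A u x) (shared-address Xx Xx₀) (∈-address x v)

      covered : Dec (v < suc m) → InED m A X
      covered (yes v<) =
        let (Y , X⊆Y , Y∈B) = extend-to-selector X⊆At λ n Xx Xy x∈ y∈ →
              same-branch⇒≡ Xx Xy v< (trans (branch-unique |t| x∈) (sym (branch-unique |t| y∈)))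
        in covered-by-generator (inj₂ Y∈B) X⊆Y
      covered (no v≮) =
        covered-by-generator (inj₁ (t , trans |t| (≤-antisym (≤-pred (toℕ<n e)) (≮⇒≥ v≮)) , X⊆At)) id

  ¬arrow : ¬ Arrow (InED m A) (suc (suc m))
  ¬arrow arrow with arrow splitColour
  ... | X , X∉ED , e , X-hom = X∉ED (homogeneous-InED X-hom)

-- A homogeneous positive set

Eventually : ∀ {ℓ} → (ℕ → Set ℓ) → Set ℓ
Eventually P = ∃ λ b → ∀ {r} → b ≤ r → P r

eventually-∩ : ∀ {ℓ ℓ′} {P : ℕ → Set ℓ} {Q : ℕ → Set ℓ′} →
               Eventually P → Eventually Q → Eventually (λ r → P r × Q r)
eventually-∩ (b , P≥b) (b′ , Q≥b′) = b ⊔ b′ , λ b⊔b′≤r →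
  P≥b (≤-trans (m≤m⊔n b b′) b⊔b′≤r) , Q≥b′ (≤-trans (m≤n⊔m b b′) b⊔b′≤r)

eventually-All : ∀ {Gs : List Subset} {P : Subset → ℕ → Set} →
                 All (λ G → Eventually (P G)) Gs → Eventually (λ r → All (λ G → P G r) Gs)
eventually-All []         = 0 , λ _ → []
eventually-All (ev ∷ evs) with eventually-∩ ev (eventually-All evs)
... | b , both = b , λ b≤r → proj₁ (both b≤r) ∷ proj₂ (both b≤r)

module HomogeneousPositiveSet (lem : ExcludedMiddle (Level.suc 0ℓ)) {A : List ℕ → Subset} (TF : TreeFamily A)
                              (m : ℕ) (c : ℕ → ℕ → Fin (suc m)) where
  open TreeFamily TF
  open Addresses TF
  open Ramsey lem
  open InfiniteSubset

  D K : ℕ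
  D = suc m
  K = suc D

  c̃ : ℕ → ℕ → Fin (suc m)
  c̃ x y = c (x ⊓ y) (x ⊔ y)

  c̃-comm : ∀ x y → c̃ x y ≡ c̃ y x
  c̃-comm x y = cong₂ c (⊓-comm x y) (⊔-comm x y)

  c̃-< : ∀ {x y} → x < y → c̃ x y ≡ c x y
  c̃-< x<y = cong₂ c (m≤n⇒m⊓n≡m (<⇒≤ x<y)) (m≤n⇒m⊔n≡n (<⇒≤ x<y))

  -- The (Σ w)-th element of the node A (take D w): the sum dominates every entry of w and, for
  -- lists of length K with the same first D entries, determines the last one.
  point : List ℕ → ℕ
  point w = enumerate (infinite (take D w)) (sum w)

  point-∈ : ∀ (w : List ℕ) → A (take D w) (point w)
  point-∈ w = enumerate-∈ (infinite (take D w)) (sum w)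

  length-take-D : ∀ (w : List ℕ) → length w ≡ K → length (take D w) ≡ D
  length-take-D w |w| = trans (length-take D w) (trans (cong (D ⊓_) |w|) (m≤n⇒m⊓n≡m (n≤1+n D)))

  address-point : ∀ (w : List ℕ) {L} → length w ≡ K → L ≤ D → address (point w) L ≡ take L w
  address-point w {L} |w| L≤D = begin
    address (point w) L          ≡⟨ address-take D L≤D ⟨
    take L (address (point w) D) ≡⟨ cong (take L) (address-unique D (take D w) (length-take-D w |w|) (point-∈ w)) ⟨
    take L (take D w)            ≡⟨ take-take L D w ⟩
    take (L ⊓ D) w               ≡⟨ cong (λ n → take n w) (m≤n⇒m⊓n≡m L≤D) ⟩
    take L w                     ∎
    where open ≡-Reasoning

  ∈⇒≤point : ∀ {x w} → x ∈ w → x ≤ point w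
  ∈⇒≤point {w = w} x∈w =
    ≤-trans (∈⇒≤sum x∈w) (strictlyIncreasing⇒inflationary (enumerate-↑ (infinite (take D w))) (sum w))

  point-injective : ∀ u v → length u ≡ K → length v ≡ K → point u ≡ point v → u ≡ v
  point-injective u v |u| |v| pu≡pv = begin
    u                    ≡⟨ take++drop≡id D u ⟨
    take D u ++ drop D u ≡⟨ cong₂ _++_ takes drops ⟩
    take D v ++ drop D v ≡⟨ take++drop≡id D v ⟩
    v                    ∎
    where
    open ≡-Reasoning
    takes : take D u ≡ take D v
    takes = trans (sym (address-point u |u| ≤-refl))
                  (trans (cong (λ x → address x D) pu≡pv) (address-point v |v| ≤-refl))
    sums : sum u ≡ sum v
    sums = strictlyIncreasing⇒injective (enumerate-↑ (infinite (take D v)))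
             (subst (λ t → enumerate (infinite t) (sum u) ≡ point v) takes pu≡pv)
    sum-split : ∀ (w : List ℕ) → sum w ≡ sum (take D w) + sum (drop D w)
    sum-split w = trans (cong sum (sym (take++drop≡id D w))) (sum-++ (take D w) (drop D w))
    singleton : ∀ (w : List ℕ) → length w ≡ K → drop D w ≡ [ sum (drop D w) ]
    singleton w |w| = length≡1⇒≡[sum] (trans (length-drop D w) (trans (cong (_∸ D) |w|) (m+n∸n≡m 1 D)))
    drop-sums : sum (drop D u) ≡ sum (drop D v)
    drop-sums = +-cancelˡ-≡ (sum (take D v)) _ _ (begin
      sum (take D v) + sum (drop D u) ≡⟨ cong (λ t → sum t + sum (drop D u)) takes ⟨
      sum (take D u) + sum (drop D u) ≡⟨ sum-split u ⟨
      sum u                           ≡⟨ sums ⟩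
      sum v                           ≡⟨ sum-split v ⟩
      sum (take D v) + sum (drop D v) ∎)
    drops : drop D u ≡ drop D v
    drops = trans (singleton u |u|) (trans (cong [_] drop-sums) (sym (singleton v |v|)))

  pairColour : ℕ → List ℕ → Fin (suc m)
  pairColour τ w = c̃ (point (take K w)) (point (take τ w ++ drop K w))

  pairColour-++ : ∀ {τ} (u v : List ℕ) → τ ≤ K → length u ≡ K → take τ u ≡ take τ v →
                  pairColour τ (u ++ drop τ v) ≡ c̃ (point u) (point v)
  pairColour-++ {τ} u v τ≤K |u| uτ≡vτ = cong₂ (λ x y → c̃ (point x) (point y)) (take-length-++ u |u|) (begin
    take τ (u ++ drop τ v) ++ drop K (u ++ drop τ v)
      ≡⟨ cong₂ _++_ (take-++ u (≤-trans τ≤K (≤-reflexive (sym |u|)))) (drop-length-++ u |u|) ⟩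
    take τ u ++ drop τ v ≡⟨ cong (_++ drop τ v) uτ≡vτ ⟩
    take τ v ++ drop τ v ≡⟨ take++drop≡id τ v ⟩
    v                    ∎)
    where open ≡-Reasoning

  ColouredAt : (ℕ → ℕ) → ℕ → Fin (suc m) → Set
  ColouredAt h τ e = ∀ {z z′ : List ℕ} → length z ≡ K → length z′ ≡ K → take τ z ≡ take τ z′ →
                     Increasing (z ++ drop τ z′) → c̃ (point (map h z)) (point (map h z′)) ≡ e

  homogeneous⇒colouredAt : ∀ {H h τ e} → (∀ n → H (h n)) → StrictlyIncreasing h → τ ≤ K →
                           Homogeneous (pairColour τ) (K + (K ∸ τ)) H e → ColouredAt h τ e
  homogeneous⇒colouredAt {H} {h} {τ} {e} h∈H h↑ τ≤K hom {z} {z′} |z| |z′| zτ≡z′τ z↑ = begin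
    c̃ (point (map h z)) (point (map h z′))
      ≡⟨ pairColour-++ (map h z) (map h z′) τ≤K (trans (length-map h z) |z|)
           (trans (take-map τ z) (trans (cong (map h) zτ≡z′τ) (sym (take-map τ z′)))) ⟨
    pairColour τ (map h z ++ drop τ (map h z′))
      ≡⟨ cong (λ y → pairColour τ (map h z ++ y)) (drop-map τ z′) ⟩
    pairColour τ (map h z ++ map h (drop τ z′))
      ≡⟨ cong (pairColour τ) (map-++ h z (drop τ z′)) ⟨
    pairColour τ (map h (z ++ drop τ z′))
      ≡⟨ hom (map h (z ++ drop τ z′)) length-≡ (map-increasing h↑ z↑) (All.map⁺ (All.universal (h∈H) _)) ⟩
    e ∎
    where
    open ≡-Reasoning
    length-≡ : length (map h (z ++ drop τ z′)) ≡ K + (K ∸ τ)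
    length-≡ = trans (length-map h (z ++ drop τ z′))
      (trans (length-++ z {drop τ z′}) (cong₂ _+_ |z| (trans (length-drop τ z′) (cong (_∸ τ) |z′|))))

  module Rows (h : ℕ → ℕ) (h↑ : StrictlyIncreasing h) (i p q : ℕ) (K≡ : i + suc p + suc q ≡ K)
              {e : Fin (suc m)} (coloured-i : ColouredAt h i e) (coloured-j : ColouredAt h (i + suc p) e) where

    d j W : ℕ
    d = suc p
    j = i + d
    W = suc q

    -- Row r is built in the block [B r, B (suc r)) of indices: all its points share the
    -- first j indices T ++ R r, and its s-th point ends with the block E r s.
    B : ℕ → ℕ
    B zero    = i
    B (suc r) = B r + d + suc r * W

    start : ℕ → ℕ → ℕ
    start r s = B r + d + s * W

    T : List ℕ
    T = interval 0 i

    R : ℕ → List ℕ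
    R r = interval (B r) d

    E : ℕ → ℕ → List ℕ
    E r s = interval (start r s) W

    I : ℕ → ℕ → List ℕ
    I r s = T ++ (R r ++ E r s)

    rowPoint : ℕ → ℕ → ℕ
    rowPoint r s = point (map h (I r s))

    Points : Subset
    Points x = ∃₂ λ r s → s ≤ r × rowPoint r s ≡ x

    B-↑ : StrictlyIncreasing B
    B-↑ r = <-≤-trans (m<m+n (B r) z<s) (m≤m+n (B r + d) (suc r * W))

    start-gap : ∀ {r s s′} → s < s′ → start r s + W ≤ start r s′
    start-gap {r} {s} {s′} s<s′ = begin
      B r + d + s * W + W   ≡⟨ +-assoc (B r + d) (s * W) W ⟩
      B r + d + (s * W + W) ≡⟨ cong (B r + d +_) (+-comm (s * W) W) ⟩
      B r + d + suc s * W   ≤⟨ +-monoʳ-≤ (B r + d) (*-monoˡ-≤ W s<s′) ⟩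
      B r + d + s′ * W      ∎
      where open ≤-Reasoning

    row-end : ∀ {r r′ s} → s ≤ r → r < r′ → start r s + W ≤ B r′
    row-end {r} s≤r r<r′ = ≤-trans (start-gap {r} (s≤s s≤r)) (strictlyIncreasing⇒mono-≤ B-↑ r<r′)

    i≤B : ∀ r → i ≤ B r
    i≤B r = strictlyIncreasing⇒mono-≤ B-↑ {0} {r} z≤n

    |T| : length T ≡ i
    |T| = length-applyUpTo _ i

    |T++R| : ∀ r → length (T ++ R r) ≡ j
    |T++R| r = trans (length-++ T) (cong₂ _+_ |T| (length-applyUpTo (_+ B r) d))

    |I| : ∀ r s → length (I r s) ≡ K
    |I| r s = trans (length-++ T)
      (trans (cong₂ _+_ |T| (trans (length-++ (R r))
                                   (cong₂ _+_ (length-applyUpTo (_+ B r) d) (length-applyUpTo (_+ start r s) W))))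
             (trans (sym (+-assoc i d W)) K≡))

    |hI| : ∀ r s → length (map h (I r s)) ≡ K
    |hI| r s = trans (length-map h (I r s)) (|I| r s)

    I-assoc : ∀ r s → I r s ≡ (T ++ R r) ++ E r s
    I-assoc r s = sym (++-assoc T (R r) (E r s))

    ++-assoc₃ : ∀ {r s} (zs : List ℕ) → I r s ++ zs ≡ T ++ (R r ++ (E r s ++ zs))
    ++-assoc₃ {r} {s} zs = trans (++-assoc T (R r ++ E r s) zs) (cong (T ++_) (++-assoc (R r) (E r s) zs))

    i<j : i < j
    i<j = m<m+n i z<s

    j≤D : j ≤ D
    j≤D = ≤-trans (m≤m+n j q) (≤-reflexive (suc-injective (trans (sym (+-suc j q)) K≡)))

    i<D : i < D
    i<D = <-≤-trans i<j j≤D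

    take-i : ∀ r s → take i (I r s) ≡ T
    take-i r s = take-length-++ T |T|

    take-j : ∀ r s → take j (I r s) ≡ T ++ R r
    take-j r s = trans (cong (take j) (I-assoc r s)) (take-length-++ (T ++ R r) (|T++R| r))

    same-row : ∀ r {s s′} → s < s′ → c̃ (rowPoint r s) (rowPoint r s′) ≡ e
    same-row r {s} {s′} s<s′ =
      coloured-j (|I| r s) (|I| r s′) (trans (take-j r s) (sym (take-j r s′)))
        (subst Increasing (sym shape)
          (proj₁ (interval-++ (i≤B r) (interval-++ (m≤m+n (B r + d) (s * W)) (interval-++ (start-gap {r} s<s′)
                   (interval-increasingFrom (start r s′) W))))))
      where
      shape : I r s ++ drop j (I r s′) ≡ T ++ (R r ++ (E r s ++ E r s′))
      shape = trans (cong (I r s ++_) (trans (cong (drop j) (I-assoc r s′)) (drop-length-++ (T ++ R r) (|T++R| r))))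
                    (++-assoc₃ {r} {s} (E r s′))

    other-row : ∀ {r s r′} s′ → s ≤ r → r < r′ → c̃ (rowPoint r s) (rowPoint r′ s′) ≡ e
    other-row {r} {s} {r′} s′ s≤r r<r′ =
      coloured-i (|I| r s) (|I| r′ s′) (trans (take-i r s) (sym (take-i r′ s′)))
        (subst Increasing (sym shape)
          (proj₁ (interval-++ (i≤B r) (interval-++ (m≤m+n (B r + d) (s * W)) (interval-++ (row-end s≤r r<r′)
                   (interval-++ (m≤m+n (B r′ + d) (s′ * W)) (interval-increasingFrom (start r′ s′) W)))))))
      where
      shape : I r s ++ drop i (I r′ s′) ≡ T ++ (R r ++ (E r s ++ (R r′ ++ E r′ s′)))
      shape = trans (cong (I r s ++_) (drop-length-++ T |T|)) (++-assoc₃ {r} {s} (R r′ ++ E r′ s′))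

    address-rowPoint : ∀ r s {L} → L ≤ D → address (rowPoint r s) L ≡ map h (take L (I r s))
    address-rowPoint r s {L} L≤D =
      trans (address-point (map h (I r s)) (|hI| r s) L≤D) (take-map L (I r s))

    row-address : ∀ r s {L} → L ≤ j → address (rowPoint r s) L ≡ map h (take L (T ++ R r))
    row-address r s {L} L≤j = trans (address-rowPoint r s (≤-trans L≤j j≤D))
      (cong (map h) (trans (cong (take L) (I-assoc r s)) (take-++ (T ++ R r) (≤-trans L≤j (≤-reflexive (sym (|T++R| r)))))))

    h[B]∈address : ∀ r s {L} → i < L → L ≤ D → h (B r) ∈ address (rowPoint r s) L
    h[B]∈address r s {L} i<L L≤D =
      subst (h (B r) ∈_) (sym (address-rowPoint r s L≤D)) (∈-map⁺ h (∈-take-++ T (subst (_< L) (sym |T|) i<L)))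

    rowPoint-≥ : ∀ r s → r ≤ rowPoint r s
    rowPoint-≥ r s = ≤-trans (strictlyIncreasing⇒inflationary B-↑ r)
      (≤-trans (strictlyIncreasing⇒inflationary h↑ (B r)) (∈⇒≤point (∈-map⁺ h (∈-++⁺ʳ T (here refl)))))

    rowPoint-injective : ∀ r {s s′} → rowPoint r s ≡ rowPoint r s′ → s ≡ s′
    rowPoint-injective r {s} {s′} eq = *-cancelʳ-≡ s s′ W (+-cancelˡ-≡ (B r + d) _ _ (∷-injectiveˡ E-eq))
      where
      I-eq : I r s ≡ I r s′
      I-eq = map-injective (strictlyIncreasing⇒injective h↑)
               (point-injective (map h (I r s)) (map h (I r s′)) (|hI| r s) (|hI| r s′) eq)
      E-eq : E r s ≡ E r s′
      E-eq = ++-cancelˡ (R r) (E r s) (E r s′) (++-cancelˡ T (R r ++ E r s) (R r ++ E r s′) I-eq)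

    distinct-points : ∀ {r s r′ s′} → s ≤ r → s′ ≤ r′ → rowPoint r s ≢ rowPoint r′ s′ →
                      c̃ (rowPoint r s) (rowPoint r′ s′) ≡ e
    distinct-points {r} {s} {r′} {s′} s≤r s′≤r′ distinct with <-cmp r r′
    ... | tri< r<r′ _ _ = other-row s′ s≤r r<r′
    ... | tri> _ _ r′<r = trans (c̃-comm _ _) (other-row s s′≤r′ r′<r)
    ... | tri≈ _ refl _ with <-cmp s s′
    ...   | tri< s<s′ _ _ = same-row r s<s′
    ...   | tri≈ _ refl _ = ⊥-elim (distinct refl)
    ...   | tri> _ _ s′<s = trans (c̃-comm _ _) (same-row r s′<s)

    Points-homogeneous : ∀ x y → Points x → Points y → x < y → c x y ≡ e
    Points-homogeneous _ _ (r , s , s≤r , refl) (r′ , s′ , s′≤r′ , refl) x<y =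
      trans (sym (c̃-< x<y)) (distinct-points s≤r s′≤r′ (<⇒≢ x<y))

    MeetsRowOnce : Subset → ℕ → Set
    MeetsRowOnce G r = ∀ {s s′} → G (rowPoint r s) → G (rowPoint r s′) → s ≡ s′

    -- A node of length > i containing a point of row r has h (B r) among its entries.
    deep-node-avoids-row : ∀ u {r} s → i < length u → sum u < r → ¬ A u (rowPoint r s)
    deep-node-avoids-row u {r} s i<|u| sum<r x∈u = <⇒≱ sum<r (begin
      r       ≤⟨ strictlyIncreasing⇒inflationary B-↑ r ⟩
      B r     ≤⟨ strictlyIncreasing⇒inflationary h↑ (B r) ⟩
      h (B r) ≤⟨ ∈⇒≤sum (∈-take (subst (h (B r) ∈_) address≡ (h[B]∈address r s i<L (m⊓n≤n _ D)))) ⟩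
      sum u   ∎)
      where
      open ≤-Reasoning
      L : ℕ
      L = length u ⊓ D
      i<L : i < L
      i<L = ⊓-glb i<|u| i<D
      address≡ : address (rowPoint r s) L ≡ take L u
      address≡ = trans (sym (address-take (length u) (m⊓n≤m _ D)))
                       (cong (take L) (sym (address-unique (length u) u refl x∈u)))

    -- All points of a row lie in the same child of a node of length ≤ i.
    shallow-selector-meets-row-once : ∀ {G} u → G ⊆ A u → (∀ n → ExactlyOne G (A (u ⌢ n))) →
                                      length u ≤ i → ∀ {r} → MeetsRowOnce G r
    shallow-selector-meets-row-once {G} u G⊆Au one |u|≤i {r} {s} {s′} Gx Gx′ =
      rowPoint-injective r (trans (unique x Gx x∈) (sym (unique x′ Gx′ x′∈)))
      where
      x x′ n : ℕ
      x = rowPoint r s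
      x′ = rowPoint r s′
      n = branch x (length u)
      unique : ∀ y → G y → A (u ⌢ n) y → y ≡ proj₁ (one n)
      unique = proj₂ (proj₂ (one n))
      u≡ : u ≡ address x (length u)
      u≡ = address-unique (length u) u refl (G⊆Au Gx)
      shared : address x′ (suc (length u)) ≡ address x (suc (length u))
      shared = trans (row-address r s′ L≤j) (sym (row-address r s L≤j))
        where
        L≤j : suc (length u) ≤ j
        L≤j = ≤-trans (s≤s |u|≤i) i<j
      x∈ : A (u ⌢ n) x
      x∈ = subst (λ t → A (t ⌢ n) x) (sym u≡) (∈-address x (suc (length u)))
      x′∈ : A (u ⌢ n) x′
      x′∈ = subst (λ t → A t x′) (trans shared (cong (_⌢ n) (sym u≡))) (∈-address x′ (suc (length u)))

    generator-meets-row-once : ∀ {G} → Generator m A G → Eventually (MeetsRowOnce G)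
    generator-meets-row-once (inj₁ (u , |u|≡D , G⊆Au)) =
      suc (sum u) , λ sum<r {s} Gx _ →
        ⊥-elim (deep-node-avoids-row u s (subst (i <_) (sym |u|≡D) i<D) sum<r (G⊆Au Gx))
    generator-meets-row-once (inj₂ (u , G⊆Au , one)) with i <? length u
    ... | yes i<|u| = suc (sum u) , λ sum<r {s} Gx _ → ⊥-elim (deep-node-avoids-row u s i<|u| sum<r (G⊆Au Gx))
    ... | no i≮|u|  = 0 , λ {r} _ → shallow-selector-meets-row-once u G⊆Au one (≮⇒≥ i≮|u|) {r}

    row-not-covered : ∀ {r} (Gs : List Subset) → All (λ G → MeetsRowOnce G r) Gs → length Gs ≤ r →
                      ¬ (∀ (s : Fin (suc r)) → Any (λ G → G (rowPoint r (toℕ s))) Gs)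
    row-not-covered {r} Gs once |Gs|≤r covering with pigeonhole (s≤s |Gs|≤r) (index ∘ covering)
    ... | s₁ , s₂ , s₁<s₂ , same-index = <-irrefl s₁≡s₂ s₁<s₂
      where
      s₁≡s₂ : toℕ s₁ ≡ toℕ s₂
      s₁≡s₂ = All.lookup once (∈-lookup (index (covering s₁))) (lookup-index (covering s₁))
                (subst (λ k → lookup Gs k (rowPoint r (toℕ s₂))) (sym same-index) (lookup-index (covering s₂)))

    Points-positive : ¬ InED m A Points
    Points-positive (N , Gs , gens , cover)
      with eventually-∩ (N , id) (eventually-∩ (length Gs , id) (eventually-All (All.map generator-meets-row-once gens)))
    ... | r , large with large ≤-refl
    ... | N≤r , |Gs|≤r , once = row-not-covered Gs once |Gs|≤r covering
      where
      covering : (s : Fin (suc r)) → Any (λ G → G (rowPoint r (toℕ s))) Gs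
      covering s with cover (rowPoint r (toℕ s)) (r , toℕ s , ≤-pred (toℕ<n s) , refl)
      ... | inj₁ <N  = ⊥-elim (<⇒≱ <N (≤-trans N≤r (rowPoint-≥ r (toℕ s))))
      ... | inj₂ any = any

  positive-from-colouredAt : ∀ {h} → StrictlyIncreasing h → (∀ (τ : Fin K) → ∃ (ColouredAt h (toℕ τ))) →
                             Σ Subset λ X → ¬ InED m A X × ∃ λ e → ∀ x y → X x → X y → x < y → c x y ≡ e
  positive-from-colouredAt {h} h↑ coloured
    with τ₁ , τ₂ , τ₁<τ₂ , same-colour ← pigeonhole (n<1+n (suc m)) (proj₁ ∘ coloured)
    with p , i+1+p≡j ← m≤n⇒∃[o]m+o≡n τ₁<τ₂
    with q , j+1+q≡K ← m≤n⇒∃[o]m+o≡n (toℕ<n τ₂)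
    = Points , Points-positive , _ , Points-homogeneous
    where
    j≡ : toℕ τ₁ + suc p ≡ toℕ τ₂
    j≡ = trans (+-suc (toℕ τ₁) p) i+1+p≡j

    open Rows h h↑ (toℕ τ₁) p q (trans (cong (_+ suc q) j≡) (trans (+-suc (toℕ τ₂) q) j+1+q≡K))
              (proj₂ (coloured τ₁)) (subst₂ (ColouredAt h) (sym j≡) (sym same-colour) (proj₂ (coloured τ₂)))

  homogeneous-positive : Σ Subset λ X → ¬ InED m A X × ∃ λ e → ∀ x y → X x → X y → x < y → c x y ≡ e
  homogeneous-positive = positive-from-colouredAt (enumerate-↑ (carrier-infinite H)) λ τ →
    let (e , hom) = property H τ in e , homogeneous⇒colouredAt (enumerate-∈ (carrier-infinite H))
      (enumerate-↑ (carrier-infinite H)) (<⇒≤ (toℕ<n τ)) hom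
    where
    H : InfiniteSubset U (λ H → ∀ (τ : Fin K) → ∃ (Homogeneous (pairColour (toℕ τ)) (K + (K ∸ toℕ τ)) H))
    H = ramsey-family (λ τ → pairColour (toℕ τ)) (λ τ → K + (K ∸ toℕ τ)) (λ N → N , ≤-refl , tt)

theorem2p1 : ExcludedMiddle (Level.suc 0ℓ) →
    (A : List ℕ → Subset) → TreeFamily A → (m : ℕ) →
    Arrow (InED m A) (suc m) × ¬ Arrow (InED m A) (suc (suc m))
theorem2p1 lem A TF m = HomogeneousPositiveSet.homogeneous-positive lem TF m , SplitLevelColouring.¬arrow lem TF m
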